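{- For every integer $k\geq 1$ and every $\rho\in\mathcal{BS}_\infty$ whose first $k$ entries $(\rho_1,\ldots,\rho_k)$ form a $k$-fuse, the generating function \[ u_k(x)=\sum x^{m}, \] the sum over all legal move sequences $(j_1,\ldots,j_m)$ from $\rho$ with all $j_t\in\{1,\ldots,k\}$, satisfies \[ u_k(x)=\sum_{i=0}^{k}c_{i,k-i}\,x^i, \] where $c_{a,b}$ denotes the number of weak compositions of $a$ (finite sequences of nonnegative integers summing to $a$) having exactly $b$ entries equal to $0$.
   Context: A barred sequence is a sequence $\mu=(\mu_1,\mu_2,\ldots)$ of nonnegative integers together with a set of barred (playable) positions, only nonzero entries being barred. For a barred position $j$, the move $R_j$ gives $\mu'=R_j(\mu)$: if $j=1$, $\mu'_i=\mu_{i+1}$ for all $i$; if $j\geq 2$, $\mu'_i=\mu_i$ for $i<j-1$, $\mu'_{j-1}=\mu_{j-1}+\mu_j$, and $\mu'_i=\mu_{i+1}$ for $i\geq j$. The bars of $\mu'$: a position $i\le j-1$ is barred iff $\mu'_i\neq0$; a position $i\geq j$ is barred iff $\mu'_i\neq 0$ and $\sum_{r=j}^{i}\mu_r<3$. A legal move sequence from $\mu$ is a finite sequence $(j_1,\ldots,j_m)$ such that each $R_{j_t}$ is applied at a barred position of the current sequence. The set $\mathcal{BS}_\infty$: for a primitive necklace $P$ (cyclic class of words in $\{B,W\}$, not a proper power) of length $n$ and $\ell\ge1$, let $\mathcal{O}_{P^\ell}$ be the Bulgarian Solitaire orbit of the necklace $P^\ell$ (partitions eventually mapped by Bulgarian Solitaire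 into the recurrent cycle corresponding to $P^\ell$); encode each $\lambda\in\mathcal{O}_{P^\ell}$ by $\mu_i=\lambda_i-\lambda_{i+1}$, with position $j$ barred iff $\mu_j\neq 0$ and $\lambda_j\geq(\text{number of nonzero parts of }\lambda)-1$. If there is an index $i$ such that no position among $i,\ldots,i+n-1$ is barred and $(\mu_i,\ldots,\mu_{i+n-1})=(a_1,\ldots,a_n)$, where for some rotation $(b_1,\ldots,b_n)$ of a word of $P$, $a_r=2$ if $b_rb_{r+1}=BW$, $a_r=1$ if $b_rb_{r+1}\in\{BB,WW\}$, $a_r=0$ if $b_rb_{r+1}=WB$ (indices mod $n$), then replacing $(\mu_{i+n},\mu_{i+n+1},\ldots)$ by infinitely many copies of $(\mu_i,\ldots,\mu_{i+n-1})$ (keeping the bars) gives an element of $\mathcal{BS}_\infty$; $\mathcal{BS}_\infty$ is the set of all elements so obtained. A $k$-fuse is a tuple $(\mu_1,\ldots,\mu_k)$ of entries of a barred sequence such that $\mu_1,\ldots,\mu_{k-1}\in\{1,2\}$, $\mu_k\geq 3$, positions $1,\ldots,k$ are all barred, and there are no $j\le k-1$ with $\mu_j=\mu_{j+1}=1$. -}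

module Defs where

open import Data.Nat using (ℕ; zero; suc; _+_; _∸_; _≤_; _<_; pred; _≡ᵇ_; _<ᵇ_; _≤ᵇ_; _%_)
open import Data.Bool using (Bool; true; false; if_then_else_; not; _∧_)
open import Data.List using (List; []; _∷_; length; map; concat; concatMap; replicate;
                              drop; take; _++_; zipWith; upTo; filterᵇ)
open import Data.Nat.ListAction using (sum)
open import Data.List.Relation.Unary.All using (All)
open import Data.List.Relation.Unary.Linked using (Linked)
open import Data.Product using (Σ; _×_; Σ-syntax)
open import Data.Sum using (_⊎_)
open import Relation.Binary.PropositionalEquality using (_≡_)
open import Relation.Nullary using (¬_)
open import Function using (_∘_)

nth : List ℕ → ℕ → ℕ
nth []       _       = 0
nth (x ∷ xs) zero    = x
nth (x ∷ xs) (suc i) = nth xs i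

sumFrom : (ℕ → ℕ) → ℕ → ℕ → ℕ
sumFrom f a zero    = 0
sumFrom f a (suc n) = f a + sumFrom f (suc a) n

-- x mod n (n ≥ 1; for n = 0 returns x, never used since necklaces are nonempty)
modP : ℕ → ℕ → ℕ
modP zero    x = x
modP (suc n) x = x % suc n

iter : {A : Set} → (A → A) → ℕ → A → A
iter f zero    x = x
iter f (suc t) x = f (iter f t x)

-- Barred sequences.  Infinite sequences are 0-based: val i = μ_{i+1},
-- bar i = true  iff  position i+1 is barred.

record BarredSeq : Set where
  field
    val : ℕ → ℕ
    bar : ℕ → Bool
open BarredSeq public

nonzero : ℕ → Bool
nonzero n = not (n ≡ᵇ 0)

-- The move R_j at (1-based) position j = suc J.
-- μ'_{I} (0-based): μ_I if I+1 < J ; μ_I + μ_J if I+1 = J ; μ_{I+1} otherwise.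
-- (For J = 0, i.e. j = 1, this is the shift μ'_I = μ_{I+1}.)
moveVal : ℕ → BarredSeq → ℕ → ℕ
moveVal J μ I =
  if suc I <ᵇ J then val μ I
  else if suc I ≡ᵇ J then val μ I + val μ J
  else val μ (suc I)

moveBar : ℕ → BarredSeq → ℕ → Bool
moveBar J μ I =
  if suc I ≤ᵇ J then nonzero (moveVal J μ I)
  else (nonzero (moveVal J μ I) ∧ (sumFrom (val μ) J (suc (I ∸ J)) <ᵇ 3))

move : ℕ → BarredSeq → BarredSeq
move zero    μ = μ   -- position 0 does not exist; never used by legal sequences
move (suc J) μ = record { val = moveVal J μ ; bar = moveBar J μ }

barredAt : BarredSeq → ℕ → Bool
barredAt μ zero    = false
barredAt μ (suc J) = bar μ J

legal : BarredSeq → List ℕ → Bool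
legal μ []       = true
legal μ (j ∷ js) = if barredAt μ j then legal (move j μ) js else false

wordsOver : ℕ → ℕ → List (List ℕ)
wordsOver k zero    = [] ∷ []
wordsOver k (suc m) = concatMap (λ j → map (j ∷_) (wordsOver k m)) (map suc (upTo k))

-- coefficient of x^m in u_k(x): number of legal move sequences of length m
-- from ρ using only positions in {1,...,k}
uCoeff : ℕ → BarredSeq → ℕ → ℕ
uCoeff k ρ m = length (filterᵇ (legal ρ) (wordsOver k m))

-- Such a sequence has
-- at most a nonzero entries (so length ≤ a + b) and entries ≤ a, hence
-- we enumerate all lists of length L ≤ a + b with entries in {0,...,a}.

listsOver : ℕ → ℕ → List (List ℕ)
listsOver a zero    = [] ∷ []
listsOver a (suc L) = concatMap (λ x → map (x ∷_) (listsOver a L)) (upTo (suc a))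

zeroCount : List ℕ → ℕ
zeroCount []       = 0
zeroCount (x ∷ xs) = (if x ≡ᵇ 0 then 1 else 0) + zeroCount xs

isWeakComp : ℕ → ℕ → List ℕ → Bool
isWeakComp a b w = (sum w ≡ᵇ a) ∧ (zeroCount w ≡ᵇ b)

c : ℕ → ℕ → ℕ
c a b = sum (map (λ L → length (filterᵇ (isWeakComp a b) (listsOver a L))) (upTo (suc (a + b))))

IsFuse : ℕ → BarredSeq → Set
IsFuse k ρ =
  (∀ I → suc I < k → (val ρ I ≡ 1 ⊎ val ρ I ≡ 2)) ×
  (3 ≤ val ρ (k ∸ 1)) ×
  (∀ I → I < k → bar ρ I ≡ true) ×
  (∀ I → suc I < k → ¬ (val ρ I ≡ 1 × val ρ (suc I) ≡ 1))

data Color : Set where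
  B W : Color

power : ℕ → List Color → List Color
power ℓ p = concat (replicate ℓ p)

Primitive : List Color → Set
Primitive p = (1 ≤ length p) × (∀ (q : List Color) (d : ℕ) → 2 ≤ d → ¬ (p ≡ power d q))

rotate : ℕ → List Color → List Color
rotate s p = drop s p ++ take s p

IsPartition : List ℕ → Set
IsPartition λ′ = All (λ x → 1 ≤ x) λ′ × Linked (λ x y → y ≤ x) λ′

removeZeros : List ℕ → List ℕ
removeZeros = filterᵇ nonzero

insertDesc : ℕ → List ℕ → List ℕ
insertDesc n []       = n ∷ []
insertDesc n (x ∷ xs) = if x ≤ᵇ n then n ∷ x ∷ xs else x ∷ insertDesc n xs

bs : List ℕ → List ℕ
bs λ′ = removeZeros (insertDesc (length λ′) (map pred λ′))

ind : Color → ℕ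
ind B = 1
ind W = 0

-- recurrent partition of a word w = w_1 ... w_N :
-- λ_i = (N - i) + [w_i = B]  (i = 1..N), zero parts dropped
-- (staircase (N-1, ..., 1, 0) plus the 0/1 diagonal word w).
recParts : List Color → List ℕ
recParts []       = []
recParts (x ∷ xs) = (length xs + ind x) ∷ recParts xs

rec : List Color → List ℕ
rec w = removeZeros (recParts w)

-- λ lies in the Bulgarian Solitaire orbit O_{P^ℓ}: it is eventually mapped
-- into the recurrent cycle of P^ℓ (the BS-cycle through rec (P^ℓ)).
InOrbit : List Color → ℕ → List ℕ → Set
InOrbit p ℓ λ′ = IsPartition λ′ × Σ[ t ∈ ℕ ] Σ[ s ∈ ℕ ] (iter bs t λ′ ≡ iter bs s (rec (power ℓ p)))

encVal : List ℕ → ℕ → ℕ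
encVal λ′ I = nth λ′ I ∸ nth λ′ (suc I)

encBar : List ℕ → ℕ → Bool
encBar λ′ I = nonzero (encVal λ′ I) ∧ ((length (removeZeros λ′) ∸ 1) ≤ᵇ nth λ′ I)

code : Color → Color → ℕ
code B W = 2
code B B = 1
code W W = 1
code W B = 0

codeWord : List Color → List ℕ
codeWord b = zipWith code b (rotate 1 b)

InBSinf : BarredSeq → Set
InBSinf ρ =
  Σ[ p ∈ List Color ] Primitive p ×
  Σ[ ℓ ∈ ℕ ] (1 ≤ ℓ) ×
  Σ[ λ′ ∈ List ℕ ] InOrbit p ℓ λ′ ×
  Σ[ I ∈ ℕ ] Σ[ s ∈ ℕ ]
    let n = length p
        a = codeWord (rotate s p)
    in (∀ r → r < n → encBar λ′ (I + r) ≡ false) ×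
       (∀ r → r < n → encVal λ′ (I + r) ≡ nth a r) ×
       (∀ X → val ρ X ≡ (if X <ᵇ I + n then encVal λ′ X else encVal λ′ (I + modP n (X ∸ I)))) ×
       (∀ X → bar ρ X ≡ (if X <ᵇ I + n then encBar λ′ X else encBar λ′ (I + modP n (X ∸ I))))

-- From a fuse of length a followed by a chain of c further fuse-shaped entries, the
-- playable positions below K are exactly those of the fuse and the head of the chain.
-- Playing R_{J+1} with J < a leaves a fuse of length J, ending in μ_{J-1} + μ_J, whose
-- chain is the rest of the old fuse; playing R_{a+1} shortens the chain by one.  So
-- the number of plays of length m depends only on (a, c, m) and obeys the recursion
-- defining plays.  With P s z = plays (s + z) 0 s this recursion classifies weak
-- compositions of s with z zeros by their first nonzero part; turning it into the
-- classification by the first part matches the enumeration of weak compositions in c.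
module Submission where

open import Defs
open import Data.Nat
  using (ℕ; zero; suc; _+_; _∸_; _≤_; _<_; _≡ᵇ_; _<ᵇ_; _≤ᵇ_; _⊓_; z≤n; s≤s; z<s; _≤?_; _<?_; _≟_)
open import Data.Nat.Properties
open import Data.Bool using (Bool; true; false; if_then_else_; _∧_)
open import Data.Bool.Properties using (∧-zeroʳ)
open import Data.List using (List; []; _∷_; length; map; concatMap; _++_; upTo; applyUpTo; filterᵇ)
open import Data.List.Properties using (filter-++; length-++; map-applyUpTo)
open import Data.Nat.ListAction using (sum)
open import Data.Product using (_×_; _,_)
open import Data.Sum using (_⊎_; inj₁; inj₂)
open import Function using (_∘_)
open import Relation.Binary.PropositionalEquality
open import Relation.Nullary using (¬_; contradiction)
open import Relation.Nullary.Decidable using (dec-true; dec-false; T?)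
open import Algebra.Properties.CommutativeSemigroup +-commutativeSemigroup using (interchange)
open ≡-Reasoning

sumFrom-cong : ∀ {f g : ℕ → ℕ} a n → (∀ i → a ≤ i → i < a + n → f i ≡ g i) →
               sumFrom f a n ≡ sumFrom g a n
sumFrom-cong a zero    f≗g = refl
sumFrom-cong a (suc n) f≗g =
  cong₂ _+_ (f≗g a ≤-refl (m<m+n a z<s))
            (sumFrom-cong (suc a) n λ i a<i i<a+1+n →
              f≗g i (<⇒≤ a<i) (subst (i <_) (sym (+-suc a n)) i<a+1+n))

sumFrom-zero : ∀ {f : ℕ → ℕ} a n → (∀ i → a ≤ i → i < a + n → f i ≡ 0) →
               sumFrom f a n ≡ 0
sumFrom-zero a n f≡0 = trans (sumFrom-cong a n f≡0) (zeros a n)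
  where
  zeros : ∀ a n → sumFrom (λ _ → 0) a n ≡ 0
  zeros a zero    = refl
  zeros a (suc n) = zeros (suc a) n

sumFrom-+ : ∀ (f g : ℕ → ℕ) a n →
            sumFrom (λ i → f i + g i) a n ≡ sumFrom f a n + sumFrom g a n
sumFrom-+ f g a zero    = refl
sumFrom-+ f g a (suc n) = begin
  (f a + g a) + sumFrom (λ i → f i + g i) (suc a) n
    ≡⟨ cong ((f a + g a) +_) (sumFrom-+ f g (suc a) n) ⟩
  (f a + g a) + (sumFrom f (suc a) n + sumFrom g (suc a) n)
    ≡⟨ interchange (f a) (g a) _ _ ⟩
  (f a + sumFrom f (suc a) n) + (g a + sumFrom g (suc a) n) ∎

sumFrom-split : ∀ (f : ℕ → ℕ) a n p → sumFrom f a (n + p) ≡ sumFrom f a n + sumFrom f (a + n) p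
sumFrom-split f a zero    p = cong (λ b → sumFrom f b p) (sym (+-identityʳ a))
sumFrom-split f a (suc n) p = begin
  f a + sumFrom f (suc a) (n + p)
    ≡⟨ cong (f a +_) (sumFrom-split f (suc a) n p) ⟩
  f a + (sumFrom f (suc a) n + sumFrom f (suc a + n) p)
    ≡⟨ +-assoc (f a) _ _ ⟨
  f a + sumFrom f (suc a) n + sumFrom f (suc (a + n)) p
    ≡⟨ cong (λ b → f a + sumFrom f (suc a) n + sumFrom f b p) (+-suc a n) ⟨
  f a + sumFrom f (suc a) n + sumFrom f (a + suc n) p ∎

sumFrom-last : ∀ (f : ℕ → ℕ) a n → sumFrom f a (suc n) ≡ sumFrom f a n + f (a + n)
sumFrom-last f a n = begin
  sumFrom f a (suc n)                 ≡⟨ cong (sumFrom f a) (+-comm 1 n) ⟩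
  sumFrom f a (n + 1)                 ≡⟨ sumFrom-split f a n 1 ⟩
  sumFrom f a n + (f (a + n) + 0)     ≡⟨ cong (sumFrom f a n +_) (+-identityʳ _) ⟩
  sumFrom f a n + f (a + n)           ∎

sumFrom-suc : ∀ (f : ℕ → ℕ) a n → sumFrom f (suc a) n ≡ sumFrom (f ∘ suc) a n
sumFrom-suc f a zero    = refl
sumFrom-suc f a (suc n) = cong (f (suc a) +_) (sumFrom-suc f (suc a) n)

sumFrom-offset : ∀ (f : ℕ → ℕ) a n → sumFrom f a n ≡ sumFrom (λ i → f (a + i)) 0 n
sumFrom-offset f zero    n = refl
sumFrom-offset f (suc a) n = trans (sumFrom-suc f a n) (sumFrom-offset (f ∘ suc) a n)

sumFrom-comm : ∀ (f : ℕ → ℕ → ℕ) a n b m →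
               sumFrom (λ i → sumFrom (f i) b m) a n ≡
               sumFrom (λ j → sumFrom (λ i → f i j) a n) b m
sumFrom-comm f a zero    b m = sym (sumFrom-zero b m λ _ _ _ → refl)
sumFrom-comm f a (suc n) b m = begin
  sumFrom (f a) b m + sumFrom (λ i → sumFrom (f i) b m) (suc a) n
    ≡⟨ cong (sumFrom (f a) b m +_) (sumFrom-comm f (suc a) n b m) ⟩
  sumFrom (f a) b m + sumFrom (λ j → sumFrom (λ i → f i j) (suc a) n) b m
    ≡⟨ sumFrom-+ (f a) (λ j → sumFrom (λ i → f i j) (suc a) n) b m ⟨
  sumFrom (λ j → f a j + sumFrom (λ i → f i j) (suc a) n) b m ∎

sumFrom-mono : ∀ (f : ℕ → ℕ) a {n p} → n ≤ p → sumFrom f a n ≤ sumFrom f a p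
sumFrom-mono f a z≤n       = z≤n
sumFrom-mono f a (s≤s n≤p) = +-monoʳ-≤ (f a) (sumFrom-mono f (suc a) n≤p)

sumFrom-single : ∀ (f : ℕ → ℕ) a {n} → 1 ≤ n → (∀ i → a < i → i < a + n → f i ≡ 0) →
                 sumFrom f a n ≡ f a
sumFrom-single f a {suc n} _ f≡0 =
  trans (cong (f a +_) (sumFrom-zero (suc a) n λ i a<i i<a+1+n →
                          f≡0 i a<i (subst (i <_) (sym (+-suc a n)) i<a+1+n)))
        (+-identityʳ (f a))

sum-map-applyUpTo : ∀ (g f : ℕ → ℕ) n → sum (map g (applyUpTo f n)) ≡ sumFrom (g ∘ f) 0 n
sum-map-applyUpTo g f zero    = refl
sum-map-applyUpTo g f (suc n) = cong (g (f 0) +_) (begin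
  sum (map g (applyUpTo (f ∘ suc) n))  ≡⟨ sum-map-applyUpTo g (f ∘ suc) n ⟩
  sumFrom (g ∘ f ∘ suc) 0 n            ≡⟨ sumFrom-suc (g ∘ f) 0 n ⟨
  sumFrom (g ∘ f) 1 n                  ∎)

count : {A : Set} → (A → Bool) → List A → ℕ
count p xs = length (filterᵇ p xs)

count-++ : ∀ {A : Set} (p : A → Bool) xs ys → count p (xs ++ ys) ≡ count p xs + count p ys
count-++ p xs ys = trans (cong length (filter-++ (T? ∘ p) xs ys)) (length-++ (filterᵇ p xs))

count-map : ∀ {A B : Set} (p : B → Bool) (g : A → B) xs → count p (map g xs) ≡ count (p ∘ g) xs
count-map p g []       = refl
count-map p g (x ∷ xs) with p (g x)
... | true  = cong suc (count-map p g xs)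
... | false = count-map p g xs

count-cong : ∀ {A : Set} {p q : A → Bool} → (∀ x → p x ≡ q x) →
             ∀ xs → count p xs ≡ count q xs
count-cong         p≗q []       = refl
count-cong {p = p} {q} p≗q (x ∷ xs) with p x | q x | p≗q x
... | true  | true  | refl = cong suc (count-cong p≗q xs)
... | false | false | refl = count-cong p≗q xs

count-none : ∀ {A : Set} {p : A → Bool} → (∀ x → p x ≡ false) → ∀ xs → count p xs ≡ 0
count-none         p≡false []       = refl
count-none {p = p} p≡false (x ∷ xs) with p x | p≡false x
... | false | refl = count-none p≡false xs

count-concatMap-cons : ∀ {A : Set} (p : List A → Bool) (ws : List (List A)) xs →
  count p (concatMap (λ x → map (x ∷_) ws) xs) ≡ sum (map (λ x → count (p ∘ (x ∷_)) ws) xs)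
count-concatMap-cons p ws []       = refl
count-concatMap-cons p ws (x ∷ xs) = begin
  count p (map (x ∷_) ws ++ concatMap (λ x → map (x ∷_) ws) xs)
    ≡⟨ count-++ p (map (x ∷_) ws) _ ⟩
  count p (map (x ∷_) ws) + count p (concatMap (λ x → map (x ∷_) ws) xs)
    ≡⟨ cong₂ _+_ (count-map p (x ∷_) ws) (count-concatMap-cons p ws xs) ⟩
  count (p ∘ (x ∷_)) ws + sum (map (λ x → count (p ∘ (x ∷_)) ws) xs) ∎

<ᵇ-true : ∀ {m n} → m < n → (m <ᵇ n) ≡ true
<ᵇ-true {m} {n} = dec-true (m <? n)

<ᵇ-false : ∀ {m n} → n ≤ m → (m <ᵇ n) ≡ false
<ᵇ-false {m} {n} n≤m = dec-false (m <? n) (≤⇒≯ n≤m)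

≤ᵇ-true : ∀ {m n} → m ≤ n → (m ≤ᵇ n) ≡ true
≤ᵇ-true {m} {n} = dec-true (m ≤? n)

≤ᵇ-false : ∀ {m n} → n < m → (m ≤ᵇ n) ≡ false
≤ᵇ-false {m} {n} n<m = dec-false (m ≤? n) (<⇒≱ n<m)

≡ᵇ-true : ∀ {m n} → m ≡ n → (m ≡ᵇ n) ≡ true
≡ᵇ-true {m} {n} = dec-true (m ≟ n)

≡ᵇ-false : ∀ {m n} → m ≢ n → (m ≡ᵇ n) ≡ false
≡ᵇ-false {m} {n} = dec-false (m ≟ n)

nonzero-pos : ∀ {n} → 1 ≤ n → nonzero n ≡ true
nonzero-pos {suc n} _ = refl

moveVal-below : ∀ {J μ I} → suc I < J → moveVal J μ I ≡ val μ I
moveVal-below I+1<J rewrite <ᵇ-true I+1<J = refl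

moveVal-merge : ∀ {μ I} → moveVal (suc I) μ I ≡ val μ I + val μ (suc I)
moveVal-merge {I = I} rewrite <ᵇ-false (≤-refl {suc I}) | ≡ᵇ-true (refl {x = I}) = refl

moveVal-above : ∀ {J μ I} → J ≤ I → moveVal J μ I ≡ val μ (suc I)
moveVal-above J≤I
  rewrite <ᵇ-false (m≤n⇒m≤1+n J≤I) | ≡ᵇ-false (<⇒≢ (s≤s J≤I) ∘ sym) = refl

moveBar-below : ∀ {J μ I} → suc I ≤ J → moveBar J μ I ≡ nonzero (moveVal J μ I)
moveBar-below I<J rewrite ≤ᵇ-true I<J = refl

moveBar-above : ∀ {J μ I} → J ≤ I →
  moveBar J μ I ≡ nonzero (moveVal J μ I) ∧ (sumFrom (val μ) J (suc (I ∸ J)) <ᵇ 3)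
moveBar-above J≤I rewrite ≤ᵇ-false (s≤s J≤I) = refl

record FuseShaped (f : ℕ → ℕ) (n : ℕ) : Set where
  field
    small : ∀ i → suc i < n → f i ≡ 1 ⊎ f i ≡ 2
    cap   : ∀ i → suc i ≡ n → 3 ≤ f i
    no-11 : ∀ i → suc i < n → ¬ (f i ≡ 1 × f (suc i) ≡ 1)
open FuseShaped

isFuse⇒fuseShaped : ∀ {k ρ} → IsFuse k ρ → FuseShaped (val ρ) k
isFuse⇒fuseShaped (inner , last≥3 , _ , no11) = record
  { small = inner
  ; cap   = λ { i refl → last≥3 }
  ; no-11 = no11
  }

module _ {f : ℕ → ℕ} {n : ℕ} (F : FuseShaped f n) where

  fuseShaped-inner<3 : ∀ i → suc i < n → f i < 3
  fuseShaped-inner<3 i i+1<n with small F i i+1<n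
  ... | inj₁ fi≡1 = subst (_< 3) (sym fi≡1) (s≤s (s≤s z≤n))
  ... | inj₂ fi≡2 = subst (_< 3) (sym fi≡2) ≤-refl

  fuseShaped-pos : ∀ i → i < n → 1 ≤ f i
  fuseShaped-pos i i<n with m≤n⇒m<n∨m≡n i<n
  ... | inj₂ i+1≡n = ≤-trans (s≤s z≤n) (cap F i i+1≡n)
  ... | inj₁ i+1<n with small F i i+1<n
  ...   | inj₁ fi≡1 = ≤-reflexive (sym fi≡1)
  ...   | inj₂ fi≡2 = subst (1 ≤_) (sym fi≡2) (s≤s z≤n)

  fuseShaped-pair≥3 : ∀ i → suc i < n → 3 ≤ f i + f (suc i)
  fuseShaped-pair≥3 i i+1<n with m≤n⇒m<n∨m≡n i+1<n
  ... | inj₂ i+2≡n = ≤-trans (cap F (suc i) i+2≡n) (m≤n+m (f (suc i)) (f i))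
  ... | inj₁ i+2<n with small F i i+1<n | small F (suc i) i+2<n
  ...   | inj₁ fi≡1 | inj₁ fi+1≡1 = contradiction (fi≡1 , fi+1≡1) (no-11 F i i+1<n)
  ...   | inj₁ fi≡1 | inj₂ fi+1≡2 rewrite fi≡1 | fi+1≡2 = ≤-refl
  ...   | inj₂ fi≡2 | inj₁ fi+1≡1 rewrite fi≡2 | fi+1≡1 = ≤-refl
  ...   | inj₂ fi≡2 | inj₂ fi+1≡2 rewrite fi≡2 | fi+1≡2 = s≤s (s≤s (s≤s z≤n))

fuseShaped-cong : ∀ {f g : ℕ → ℕ} {n} → (∀ i → i < n → g i ≡ f i) →
                  FuseShaped f n → FuseShaped g n
fuseShaped-cong {f} {g} g≗f F = record
  { small = λ i i+1<n → subst (λ x → x ≡ 1 ⊎ x ≡ 2) (sym (g≗f i (<⇒≤ i+1<n)))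
                               (small F i i+1<n)
  ; cap   = λ i i+1≡n → subst (3 ≤_) (sym (g≗f i (≤-reflexive i+1≡n))) (cap F i i+1≡n)
  ; no-11 = λ i i+1<n (gi≡1 , gi+1≡1) → no-11 F i i+1<n
      (trans (sym (g≗f i (<⇒≤ i+1<n))) gi≡1 , trans (sym (g≗f (suc i) i+1<n)) gi+1≡1)
  }

fuseShaped-tail : ∀ {f n} → FuseShaped f (suc n) → FuseShaped (f ∘ suc) n
fuseShaped-tail F = record
  { small = λ i i+1<n → small F (suc i) (s≤s i+1<n)
  ; cap   = λ i i+1≡n → cap F (suc i) (cong suc i+1≡n)
  ; no-11 = λ i i+1<n → no-11 F (suc i) (s≤s i+1<n)
  }

fuseShaped-drop : ∀ {f n} d → FuseShaped f (n + d) → FuseShaped (λ i → f (i + d)) n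
fuseShaped-drop {n = n} d F = record
  { small = λ i i+1<n → small F (i + d) (+-monoˡ-< d i+1<n)
  ; cap   = λ i i+1≡n → cap F (i + d) (cong (_+ d) i+1≡n)
  ; no-11 = λ i i+1<n → no-11 F (i + d) (+-monoˡ-< d i+1<n)
  }

fuseShaped-merge : ∀ {μ a J} → FuseShaped (val μ) a → J ≤ a →
                   (∀ i → suc i ≡ J → 3 ≤ val μ i + val μ J) → FuseShaped (moveVal J μ) J
fuseShaped-merge {μ} {a} {J} F J≤a merged≥3 = record
  { small = λ i i+1<J → subst (λ x → x ≡ 1 ⊎ x ≡ 2) (sym (moveVal-below {μ = μ} i+1<J))
                              (small F i (<-≤-trans i+1<J J≤a))
  ; cap   = λ { i refl → subst (3 ≤_) (sym (moveVal-merge {μ})) (merged≥3 i refl) }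
  ; no-11 = no-11′
  }
  where
  no-11′ : ∀ i → suc i < J → ¬ (moveVal J μ i ≡ 1 × moveVal J μ (suc i) ≡ 1)
  no-11′ i i+1<J (fi≡1 , fi+1≡1) with m≤n⇒m<n∨m≡n i+1<J
  ... | inj₁ i+2<J = no-11 F i (<-≤-trans i+1<J J≤a)
                       ( trans (sym (moveVal-below {μ = μ} i+1<J)) fi≡1
                       , trans (sym (moveVal-below {μ = μ} i+2<J)) fi+1≡1)
  ... | inj₂ refl = <⇒≱ (s≤s (s≤s z≤n))
                      (subst (3 ≤_) (trans (sym (moveVal-merge {μ})) fi+1≡1) (merged≥3 (suc i) refl))

sum≥3⇒unbarred : ∀ μ {J I} → J ≤ I → 3 ≤ sumFrom (val μ) J (suc (I ∸ J)) →
                 moveBar J μ I ≡ false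
sum≥3⇒unbarred μ {J} {I} J≤I 3≤sum =
  trans (moveBar-above {μ = μ} J≤I)
        (trans (cong (nonzero (moveVal J μ I) ∧_) (<ᵇ-false 3≤sum)) (∧-zeroʳ _))

chainHead-barred : ∀ μ {J n} → FuseShaped (λ i → val μ (i + J)) n → 2 ≤ n →
                   moveBar J μ J ≡ true
chainHead-barred μ {J} T 2≤n rewrite moveBar-above {J} {μ} ≤-refl | n∸n≡0 J
                                   | moveVal-above {J} {μ} ≤-refl
                                   | nonzero-pos (fuseShaped-pos T 1 2≤n)
                                   | +-identityʳ (val μ J) =
  <ᵇ-true (fuseShaped-inner<3 T 0 2≤n)

beyondChainHead-unbarred : ∀ μ {J c I} → FuseShaped (λ i → val μ (i + J)) (suc c) →
                           1 ⊓ c + J ≤ I → moveBar J μ I ≡ false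
beyondChainHead-unbarred μ {J} {zero}  T J≤I =
  sum≥3⇒unbarred μ J≤I (≤-trans (cap T 0 refl) (m≤m+n (val μ J) _))
beyondChainHead-unbarred μ {J} {suc c} T J<I =
  sum≥3⇒unbarred μ (<⇒≤ J<I)
    (≤-trans (subst (3 ≤_) (cong (val μ J +_) (sym (+-identityʳ _)))
                    (fuseShaped-pair≥3 T 0 (s≤s (s≤s z≤n))))
             (sumFrom-mono (val μ) J (s≤s (m<n⇒0<n∸m J<I))))

record Position (K a c : ℕ) (μ : BarredSeq) : Set where
  field
    fuse         : FuseShaped (val μ) a
    chain        : FuseShaped (λ i → val μ (i + a)) c
    fuseBarred   : ∀ I → I < a → bar μ I ≡ true
    chainBarred  : 1 ≤ c → bar μ a ≡ true
    restUnbarred : ∀ I → 1 ⊓ c + a ≤ I → I < K → bar μ I ≡ false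
    fits         : a + c ≤ K
open Position

isFuse⇒position : ∀ {k ρ} → IsFuse k ρ → Position k k 0 ρ
isFuse⇒position isFuse@(_ , _ , barred , _) = record
  { fuse         = isFuse⇒fuseShaped isFuse
  ; chain        = record { small = λ _ () ; cap = λ _ () ; no-11 = λ _ () }
  ; fuseBarred   = barred
  ; chainBarred  = λ ()
  ; restUnbarred = λ I k≤I I<k → contradiction k≤I (<⇒≱ I<k)
  ; fits         = ≤-reflexive (+-identityʳ _)
  }

positionAfterMove : ∀ {K J c μ} → FuseShaped (moveVal J μ) J →
                    FuseShaped (λ i → val μ (i + J)) (suc c) → J + c ≤ K →
                    Position K J c (move (suc J) μ)
positionAfterMove {K} {J} {c} {μ} F T J+c≤K = record
  { fuse         = F
  ; chain        = fuseShaped-cong (λ i _ → moveVal-above {μ = μ} (m≤n+m J i)) (fuseShaped-tail T)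
  ; fuseBarred   = λ I I<J → trans (moveBar-below {μ = μ} I<J) (nonzero-pos (fuseShaped-pos F I I<J))
  ; chainBarred  = λ 1≤c → chainHead-barred μ T (s≤s 1≤c)
  ; restUnbarred = λ I c⊓1+J≤I _ → beyondChainHead-unbarred μ T c⊓1+J≤I
  ; fits         = J+c≤K
  }

moveInFuse : ∀ {K a c μ J} → Position K a c μ → J < a → Position K J (a ∸ suc J) (move (suc J) μ)
moveInFuse {K} {a} {c} {μ} {J} P J<a =
  positionAfterMove {μ = μ} (fuseShaped-merge {μ} (fuse P) (<⇒≤ J<a) merged≥3) fuseFromJ fits′
  where
  a-split : a ≡ suc (a ∸ suc J) + J
  a-split = sym (trans (sym (+-suc (a ∸ suc J) J)) (m∸n+n≡m J<a))
  fuseFromJ : FuseShaped (λ i → val μ (i + J)) (suc (a ∸ suc J))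
  fuseFromJ = fuseShaped-drop J (subst (FuseShaped (val μ)) a-split (fuse P))
  merged≥3 : ∀ i → suc i ≡ J → 3 ≤ val μ i + val μ J
  merged≥3 i refl = fuseShaped-pair≥3 (fuse P) i J<a
  fits′ : J + (a ∸ suc J) ≤ K
  fits′ = ≤-trans (≤-trans (n≤1+n _) (≤-reflexive (m+[n∸m]≡n J<a)))
                  (≤-trans (m≤m+n a c) (fits P))

moveInChain : ∀ {K a c μ} → Position K a (suc c) μ → Position K a c (move (suc a) μ)
moveInChain {K} {a} {c} {μ} P =
  positionAfterMove {μ = μ} (fuseShaped-merge {μ} (fuse P) ≤-refl merged≥3) (chain P)
                    (≤-trans (+-monoʳ-≤ a (n≤1+n c)) (fits P))
  where
  merged≥3 : ∀ i → suc i ≡ a → 3 ≤ val μ i + val μ a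
  merged≥3 i i+1≡a = ≤-trans (cap (fuse P) i i+1≡a) (m≤m+n _ _)

uCoeff-suc : ∀ K μ m →
  uCoeff K μ (suc m) ≡ sumFrom (λ J → if bar μ J then uCoeff K (move (suc J) μ) m else 0) 0 K
uCoeff-suc K μ m = begin
  count (legal μ) (concatMap (λ j → map (j ∷_) (wordsOver K m)) (map suc (upTo K)))
    ≡⟨ count-concatMap-cons (legal μ) (wordsOver K m) (map suc (upTo K)) ⟩
  sum (map firstMove (map suc (upTo K)))
    ≡⟨ cong (sum ∘ map firstMove) (map-applyUpTo (λ i → i) suc K) ⟩
  sum (map firstMove (applyUpTo suc K))
    ≡⟨ sum-map-applyUpTo firstMove suc K ⟩
  sumFrom (firstMove ∘ suc) 0 K
    ≡⟨ sumFrom-cong 0 K (λ J _ _ → firstMove-suc J) ⟩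
  sumFrom (λ J → if bar μ J then uCoeff K (move (suc J) μ) m else 0) 0 K ∎
  where
  firstMove : ℕ → ℕ
  firstMove j = count (legal μ ∘ (j ∷_)) (wordsOver K m)
  firstMove-suc : ∀ J → firstMove (suc J) ≡ (if bar μ J then uCoeff K (move (suc J) μ) m else 0)
  firstMove-suc J with bar μ J
  ... | true  = refl
  ... | false = count-none (λ _ → refl) (wordsOver K m)

mutual
  plays : ℕ → ℕ → ℕ → ℕ
  plays a c       zero    = 1
  plays a zero    (suc m) = fusePlays a m
  plays a (suc c) (suc m) = plays a c m + fusePlays a m

  fusePlays : ℕ → ℕ → ℕ
  fusePlays a m = sumFrom (λ J → plays J (a ∸ suc J) m) 0 a

uCoeff-position : ∀ m {K a c μ} → Position K a c μ → uCoeff K μ m ≡ plays a c m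
uCoeff-position zero    P = refl
uCoeff-position (suc m) {K} {a} {c} {μ} P = begin
  uCoeff K μ (suc m)
    ≡⟨ uCoeff-suc K μ m ⟩
  sumFrom afterMove 0 K
    ≡⟨ cong (sumFrom afterMove 0) (m+[n∸m]≡n a≤K) ⟨
  sumFrom afterMove 0 (a + (K ∸ a))
    ≡⟨ sumFrom-split afterMove 0 a (K ∸ a) ⟩
  sumFrom afterMove 0 a + sumFrom afterMove a (K ∸ a)
    ≡⟨ cong (_+ sumFrom afterMove a (K ∸ a)) inFuse ⟩
  fusePlays a m + sumFrom afterMove a (K ∸ a)
    ≡⟨ inChain c P ⟩
  plays a c (suc m) ∎
  where
  afterMove : ℕ → ℕ
  afterMove J = if bar μ J then uCoeff K (move (suc J) μ) m else 0
  a≤K : a ≤ K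
  a≤K = ≤-trans (m≤m+n a c) (fits P)
  unbarred : ∀ {c} → Position K a c μ →
             ∀ J → 1 ⊓ c + a ≤ J → J < a + (K ∸ a) → afterMove J ≡ 0
  unbarred P J c⊓1+a≤J J<K
    rewrite restUnbarred P J c⊓1+a≤J (subst (J <_) (m+[n∸m]≡n a≤K) J<K) = refl
  inFuse : sumFrom afterMove 0 a ≡ fusePlays a m
  inFuse = sumFrom-cong 0 a λ J _ J<a →
    trans (cong (λ b → if b then uCoeff K (move (suc J) μ) m else 0) (fuseBarred P J J<a))
          (uCoeff-position m (moveInFuse P J<a))
  inChain : ∀ c → Position K a c μ →
            fusePlays a m + sumFrom afterMove a (K ∸ a) ≡ plays a c (suc m)
  inChain zero    P = trans (cong (fusePlays a m +_) (sumFrom-zero a (K ∸ a) (unbarred P)))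
                            (+-identityʳ _)
  inChain (suc c) P = begin
    fusePlays a m + sumFrom afterMove a (K ∸ a)
      ≡⟨ cong (fusePlays a m +_) (sumFrom-single afterMove a 1≤K∸a (unbarred P)) ⟩
    fusePlays a m + afterMove a
      ≡⟨ cong (fusePlays a m +_) chainMove ⟩
    fusePlays a m + plays a c m
      ≡⟨ +-comm (fusePlays a m) _ ⟩
    plays a c m + fusePlays a m ∎
    where
    1≤K∸a : 1 ≤ K ∸ a
    1≤K∸a = m<n⇒0<n∸m (<-≤-trans (m<m+n a z<s) (fits P))
    chainMove : afterMove a ≡ plays a c m
    chainMove rewrite chainBarred P (s≤s z≤n) = uCoeff-position m (moveInChain P)

mutual
  plays-vanish : ∀ a c m → a + c < m → plays a c m ≡ 0
  plays-vanish a zero    (suc m) a+0<1+m =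
    fusePlays-vanish a m (subst (_≤ m) (+-identityʳ a) (≤-pred a+0<1+m))
  plays-vanish a (suc c) (suc m) a+1+c<1+m =
    cong₂ _+_ (plays-vanish a c m a+c<m) (fusePlays-vanish a m (≤-trans (m≤m+n a c) (<⇒≤ a+c<m)))
    where
    a+c<m : a + c < m
    a+c<m = subst (_≤ m) (+-suc a c) (≤-pred a+1+c<1+m)

  fusePlays-vanish : ∀ a m → a ≤ m → fusePlays a m ≡ 0
  fusePlays-vanish a m a≤m = sumFrom-zero 0 a λ J _ J<a →
    plays-vanish J (a ∸ suc J) m
      (<-≤-trans (n<1+n _) (subst (_≤ m) (sym (m+[n∸m]≡n J<a)) a≤m))

fusePlays-suc : ∀ k m →
  fusePlays (suc k) (suc m) ≡ fusePlays k m + sumFrom (λ J → plays J 0 (suc m)) 0 (suc k)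
fusePlays-suc k m = begin
  sumFrom (λ J → plays J (k ∸ J) (suc m)) 0 (suc k)
    ≡⟨ sumFrom-last _ 0 k ⟩
  sumFrom (λ J → plays J (k ∸ J) (suc m)) 0 k + plays k (k ∸ k) (suc m)
    ≡⟨ cong₂ _+_ (sumFrom-cong 0 k λ J _ J<k → cong (λ c → plays J c (suc m)) (∸-suc J<k))
                 (cong (λ c → plays k c (suc m)) (n∸n≡0 k)) ⟩
  sumFrom (λ J → plays J (k ∸ suc J) m + plays J 0 (suc m)) 0 k + plays k 0 (suc m)
    ≡⟨ cong (_+ plays k 0 (suc m)) (sumFrom-+ _ _ 0 k) ⟩
  fusePlays k m + sumFrom (λ J → plays J 0 (suc m)) 0 k + plays k 0 (suc m)
    ≡⟨ +-assoc (fusePlays k m) _ _ ⟩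
  fusePlays k m + (sumFrom (λ J → plays J 0 (suc m)) 0 k + plays k 0 (suc m))
    ≡⟨ cong (fusePlays k m +_) (sumFrom-last _ 0 k) ⟨
  fusePlays k m + sumFrom (λ J → plays J 0 (suc m)) 0 (suc k) ∎
  where
  ∸-suc : ∀ {J k} → J < k → k ∸ J ≡ suc (k ∸ suc J)
  ∸-suc {zero}  {suc k} _         = refl
  ∸-suc {suc J} {suc k} (s≤s J<k) = ∸-suc J<k

delay : (ℕ → ℕ) → ℕ → ℕ
delay f zero    = 0
delay f (suc n) = f n

sumFrom-delay : ∀ (f : ℕ → ℕ → ℕ) a n z →
                sumFrom (λ i → delay (f i) z) a n ≡ delay (λ z → sumFrom (λ i → f i z) a n) z
sumFrom-delay f a n zero    = sumFrom-zero a n λ _ _ _ → refl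
sumFrom-delay f a n (suc z) = refl

-- Read g s z as the number of weak compositions of s with z zeros.  The first recurrence
-- classifies them by the first part; the second by the first nonzero part, which is
-- deleted together with the zeros before it if it is 1, and decremented otherwise.
record FirstPartRecurrence (g : ℕ → ℕ → ℕ) : Set where
  field
    empty    : ∀ z → g 0 z ≡ 1
    nonempty : ∀ s z → g (suc s) z ≡ delay (g (suc s)) z + sumFrom (λ y → g (s ∸ y) z) 0 (suc s)

record FirstNonzeroPartRecurrence (g : ℕ → ℕ → ℕ) : Set where
  field
    empty  : ∀ z → g 0 z ≡ 1
    unit   : ∀ z → g 1 z ≡ sumFrom (g 0) 0 (suc z)
    larger : ∀ s z → g (suc (suc s)) z ≡ g (suc s) z + sumFrom (g (suc s)) 0 (suc z)

firstNonzeroPart⇒firstPart : ∀ {g} → FirstNonzeroPartRecurrence g → FirstPartRecurrence g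
firstNonzeroPart⇒firstPart {g} G = record { empty = empty ; nonempty = nonempty }
  where
  open FirstNonzeroPartRecurrence G
  firstParts : ℕ → ℕ → ℕ
  firstParts s z = sumFrom (λ y → g (s ∸ y) z) 0 (suc s)
  firstParts-suc : ∀ s z → firstParts (suc s) z ≡ g (suc s) z + firstParts s z
  firstParts-suc s z = cong (g (suc s) z +_) (sumFrom-suc _ 0 (suc s))
  nonempty : ∀ s z → g (suc s) z ≡ delay (g (suc s)) z + firstParts s z
  nonempty zero    zero    = unit 0
  nonempty (suc s) zero    = begin
    g (suc (suc s)) 0                  ≡⟨ larger s 0 ⟩
    g (suc s) 0 + (g (suc s) 0 + 0)    ≡⟨ cong (g (suc s) 0 +_) (+-identityʳ _) ⟩
    g (suc s) 0 + g (suc s) 0          ≡⟨ cong (g (suc s) 0 +_) (nonempty s 0) ⟩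
    g (suc s) 0 + firstParts s 0       ≡⟨ firstParts-suc s 0 ⟨
    firstParts (suc s) 0               ∎
  nonempty zero    (suc z) = begin
    g 1 (suc z)                             ≡⟨ unit (suc z) ⟩
    sumFrom (g 0) 0 (suc (suc z))           ≡⟨ sumFrom-last (g 0) 0 (suc z) ⟩
    sumFrom (g 0) 0 (suc z) + g 0 (suc z)   ≡⟨ cong₂ _+_ (unit z) (+-identityʳ _) ⟨
    g 1 z + firstParts 0 (suc z)            ∎
  nonempty (suc s) (suc z) = begin
    g (2 + s) (suc z)
      ≡⟨ larger s (suc z) ⟩
    g (suc s) (suc z) + sumFrom (g (suc s)) 0 (suc (suc z))
      ≡⟨ cong₂ _+_ (nonempty s (suc z)) (sumFrom-last (g (suc s)) 0 (suc z)) ⟩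
    (g (suc s) z + firstParts s (suc z)) + (sumFrom (g (suc s)) 0 (suc z) + g (suc s) (suc z))
      ≡⟨ interchange (g (suc s) z) _ _ _ ⟩
    (g (suc s) z + sumFrom (g (suc s)) 0 (suc z)) + (firstParts s (suc z) + g (suc s) (suc z))
      ≡⟨ cong₂ _+_ (larger s z) (+-comm (g (suc s) (suc z)) _) ⟨
    g (2 + s) z + (g (suc s) (suc z) + firstParts s (suc z))
      ≡⟨ cong (g (2 + s) z +_) (firstParts-suc s (suc z)) ⟨
    g (2 + s) z + firstParts (suc s) (suc z) ∎

plays-firstNonzeroPart : FirstNonzeroPartRecurrence (λ s z → plays (s + z) 0 s)
plays-firstNonzeroPart = record { empty = λ _ → refl ; unit = λ _ → refl ; larger = larger }
  where
  larger : ∀ s z → plays (2 + s + z) 0 (2 + s) ≡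
                   plays (suc s + z) 0 (suc s) + sumFrom (λ z → plays (suc s + z) 0 (suc s)) 0 (suc z)
  larger s z = begin
    fusePlays (2 + s + z) (suc s)
      ≡⟨ fusePlays-suc (suc s + z) s ⟩
    plays (suc s + z) 0 (suc s) + sumFrom column 0 (suc (suc s + z))
      ≡⟨ cong (plays (suc s + z) 0 (suc s) +_) (begin
           sumFrom column 0 (suc (suc s + z))
             ≡⟨ cong (sumFrom column 0 ∘ suc) (+-suc s z) ⟨
           sumFrom column 0 (suc s + suc z)
             ≡⟨ sumFrom-split column 0 (suc s) (suc z) ⟩
           sumFrom column 0 (suc s) + sumFrom column (suc s) (suc z)
             ≡⟨ cong₂ _+_ (sumFrom-zero 0 (suc s) λ J _ J<1+s →
                             plays-vanish J 0 (suc s) (subst (_< suc s) (sym (+-identityʳ J)) J<1+s))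
                          (sumFrom-offset column (suc s) (suc z)) ⟩
           sumFrom (λ z → plays (suc s + z) 0 (suc s)) 0 (suc z) ∎) ⟩
    plays (suc s + z) 0 (suc s) + sumFrom (λ z → plays (suc s + z) 0 (suc s)) 0 (suc z) ∎
    where
    column : ℕ → ℕ
    column J = plays J 0 (suc s)

≡ᵇ-+ˡ : ∀ n {m t} → n ≤ m → (n + t ≡ᵇ m) ≡ (t ≡ᵇ m ∸ n)
≡ᵇ-+ˡ zero    _         = refl
≡ᵇ-+ˡ (suc n) (s≤s n≤m) = ≡ᵇ-+ˡ n n≤m

module WeakCompositionsEnumeration (A : ℕ) where

  comps : ℕ → ℕ → ℕ → ℕ
  comps L s z = count (isWeakComp s z) (listsOver A L)

  compsBelow : ℕ → ℕ → ℕ → ℕ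
  compsBelow n s z = sumFrom (λ L → comps L s z) 0 n

  comps-zero∷ : ∀ L s z → count (isWeakComp s z ∘ (0 ∷_)) (listsOver A L) ≡ delay (comps L s) z
  comps-zero∷ L s zero    = count-none (λ w → ∧-zeroʳ (sum w ≡ᵇ s)) (listsOver A L)
  comps-zero∷ L s (suc z) = refl

  comps-small∷ : ∀ L {s} z {y} → y < s →
                 count (isWeakComp s z ∘ (suc y ∷_)) (listsOver A L) ≡ comps L (s ∸ suc y) z
  comps-small∷ L z {y} y<s =
    count-cong (λ w → cong (_∧ (zeroCount w ≡ᵇ z)) (≡ᵇ-+ˡ (suc y) y<s)) (listsOver A L)

  comps-large∷ : ∀ L {s} z {y} → s ≤ y →
                 count (isWeakComp s z ∘ (suc y ∷_)) (listsOver A L) ≡ 0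
  comps-large∷ L z {y} s≤y = count-none (λ w → cong (_∧ (zeroCount w ≡ᵇ z))
    (≡ᵇ-false λ 1+y+Σw≡s → <⇒≱ (subst (y <_) 1+y+Σw≡s (s≤s (m≤m+n y (sum w)))) s≤y))
    (listsOver A L)

  comps-suc : ∀ L {s} z → s ≤ A →
              comps (suc L) s z ≡ delay (comps L s) z + sumFrom (λ y → comps L (s ∸ suc y) z) 0 s
  comps-suc L {s} z s≤A = begin
    count (isWeakComp s z) (concatMap (λ x → map (x ∷_) (listsOver A L)) (upTo (suc A)))
      ≡⟨ count-concatMap-cons (isWeakComp s z) (listsOver A L) (upTo (suc A)) ⟩
    head 0 + sum (map head (applyUpTo suc A))
      ≡⟨ cong₂ _+_ (comps-zero∷ L s z) (sum-map-applyUpTo head suc A) ⟩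
    delay (comps L s) z + sumFrom (head ∘ suc) 0 A
      ≡⟨ cong (λ n → delay (comps L s) z + sumFrom (head ∘ suc) 0 n) (m+[n∸m]≡n s≤A) ⟨
    delay (comps L s) z + sumFrom (head ∘ suc) 0 (s + (A ∸ s))
      ≡⟨ cong (delay (comps L s) z +_) (sumFrom-split (head ∘ suc) 0 s (A ∸ s)) ⟩
    delay (comps L s) z + (sumFrom (head ∘ suc) 0 s + sumFrom (head ∘ suc) s (A ∸ s))
      ≡⟨ cong (λ x → delay (comps L s) z + (sumFrom (head ∘ suc) 0 s + x))
              (sumFrom-zero s (A ∸ s) λ y s≤y _ → comps-large∷ L z s≤y) ⟩
    delay (comps L s) z + (sumFrom (head ∘ suc) 0 s + 0)
      ≡⟨ cong (delay (comps L s) z +_)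
              (trans (+-identityʳ _) (sumFrom-cong 0 s λ y _ y<s → comps-small∷ L z y<s)) ⟩
    delay (comps L s) z + sumFrom (λ y → comps L (s ∸ suc y) z) 0 s ∎
    where
    head : ℕ → ℕ
    head x = count (isWeakComp s z ∘ (x ∷_)) (listsOver A L)

  -- A weak composition of s with z zeros has at most s + z parts, whence the bound on n.
  compsBelow-firstPart : ∀ {g} → FirstPartRecurrence g →
                         ∀ n s z → s + z < n → s ≤ A → compsBelow n s z ≡ g s z
  compsBelow-firstPart {g} G (suc n) zero zero _ _ =
    trans (cong suc (trans (sumFrom-suc _ 0 n) (sumFrom-zero 0 n λ L _ _ → comps-suc L 0 z≤n)))
          (sym (empty 0))
    where open FirstPartRecurrence G
  compsBelow-firstPart {g} G (suc n) zero (suc z) 1+z<1+n _ = begin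
    sumFrom (λ L → comps L 0 (suc z)) 1 n
      ≡⟨ sumFrom-suc _ 0 n ⟩
    sumFrom (λ L → comps (suc L) 0 (suc z)) 0 n
      ≡⟨ sumFrom-cong 0 n (λ L _ _ → trans (comps-suc L (suc z) z≤n) (+-identityʳ _)) ⟩
    compsBelow n 0 z
      ≡⟨ compsBelow-firstPart G n 0 z (≤-pred 1+z<1+n) z≤n ⟩
    g 0 z
      ≡⟨ trans (empty z) (sym (empty (suc z))) ⟩
    g 0 (suc z) ∎
    where open FirstPartRecurrence G
  compsBelow-firstPart {g} G (suc n) (suc s) z 1+s+z<1+n 1+s≤A = begin
    sumFrom (λ L → comps L (suc s) z) 1 n
      ≡⟨ sumFrom-suc _ 0 n ⟩
    sumFrom (λ L → comps (suc L) (suc s) z) 0 n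
      ≡⟨ sumFrom-cong 0 n (λ L _ _ → comps-suc L z 1+s≤A) ⟩
    sumFrom (λ L → delay (comps L (suc s)) z + sumFrom (λ y → comps L (s ∸ y) z) 0 (suc s)) 0 n
      ≡⟨ sumFrom-+ _ _ 0 n ⟩
    sumFrom (λ L → delay (comps L (suc s)) z) 0 n +
      sumFrom (λ L → sumFrom (λ y → comps L (s ∸ y) z) 0 (suc s)) 0 n
      ≡⟨ cong₂ _+_ (sumFrom-delay (λ L → comps L (suc s)) 0 n z)
                   (sumFrom-comm (λ L y → comps L (s ∸ y) z) 0 n 0 (suc s)) ⟩
    delay (compsBelow n (suc s)) z + sumFrom (λ y → compsBelow n (s ∸ y) z) 0 (suc s)
      ≡⟨ cong₂ _+_ (delayed z 1+s+z<1+n)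
                   (sumFrom-cong 0 (suc s) λ y _ _ →
                      compsBelow-firstPart G n (s ∸ y) z
                        (≤-<-trans (+-monoˡ-≤ z (m∸n≤m s y)) (≤-pred 1+s+z<1+n))
                        (≤-trans (m∸n≤m s y) (<⇒≤ 1+s≤A))) ⟩
    delay (g (suc s)) z + sumFrom (λ y → g (s ∸ y) z) 0 (suc s)
      ≡⟨ nonempty s z ⟨
    g (suc s) z ∎
    where
    open FirstPartRecurrence G
    delayed : ∀ z → suc s + z < suc n → delay (compsBelow n (suc s)) z ≡ delay (g (suc s)) z
    delayed zero    _ = refl
    delayed (suc z) 2+s+z<1+n =
      compsBelow-firstPart G n (suc s) z (subst (_< n) (+-suc s z) (≤-pred 2+s+z<1+n)) 1+s≤A

c≡plays : ∀ s z → c s z ≡ plays (s + z) 0 s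
c≡plays s z = begin
  sum (map (λ L → comps L s z) (upTo (suc (s + z))))
    ≡⟨ sum-map-applyUpTo (λ L → comps L s z) (λ L → L) (suc (s + z)) ⟩
  compsBelow (suc (s + z)) s z
    ≡⟨ compsBelow-firstPart (firstNonzeroPart⇒firstPart plays-firstNonzeroPart)
                            (suc (s + z)) s z ≤-refl ≤-refl ⟩
  plays (s + z) 0 s ∎
  where open WeakCompositionsEnumeration s

-- Neither 1 ≤ k nor ρ ∈ BS∞ is needed: the fuse entries alone decide every bar that matters.
proposition3p9 : (k : ℕ) → 1 ≤ k → (ρ : BarredSeq) → InBSinf ρ → IsFuse k ρ →
                   ((m : ℕ) → m ≤ k → uCoeff k ρ m ≡ c m (k ∸ m)) ×
                   ((m : ℕ) → k < m → uCoeff k ρ m ≡ 0)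
proposition3p9 k _ ρ _ isFuse = below , above
  where
  counts : ∀ m → uCoeff k ρ m ≡ plays k 0 m
  counts m = uCoeff-position m (isFuse⇒position isFuse)
  below : (m : ℕ) → m ≤ k → uCoeff k ρ m ≡ c m (k ∸ m)
  below m m≤k = begin
    uCoeff k ρ m            ≡⟨ counts m ⟩
    plays k 0 m             ≡⟨ cong (λ n → plays n 0 m) (m+[n∸m]≡n m≤k) ⟨
    plays (m + (k ∸ m)) 0 m ≡⟨ c≡plays m (k ∸ m) ⟨
    c m (k ∸ m)             ∎
  above : (m : ℕ) → k < m → uCoeff k ρ m ≡ 0
  above m k<m = trans (counts m) (plays-vanish k 0 m (subst (_< m) (sym (+-identityʳ k)) k<m))
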